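{- For all positive integers $n,m$, $$\sum_{k=1}^n(-1)^{k-1}\binom{n}{k}\frac{S_k(m)}{k}=H_n^{(m+1)},$$ where $S_k(m)=\sum_{j=1}^k\binom{k}{j}\frac{(-1)^{j-1}}{j^m}$ and $H_n^{(r)}=\sum_{i=1}^n \frac{1}{i^r}$.
   Context: $H_n^{(r)}$ denotes the generalized harmonic number $\sum_{i=1}^n i^{ -r}$. -}

module Defs where

open import Data.Nat as ℕ using (ℕ; zero; suc; _^_)
open import Data.Nat.Properties using (m^n≢0)
open import Data.Nat.Combinatorics using (_C_)
open import Data.Integer using (+_)
open import Data.Rational using (ℚ; 0ℚ; 1ℚ; _+_; _*_; -_; _/_)

sum1 : ℕ → (ℕ → ℚ) → ℚ
sum1 zero    f = 0ℚ
sum1 (suc n) f = sum1 n f + f (suc n)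

-- (-1)^(k-1) for k ≥ 1 : sign (suc i) = (-1)^i
sign : ℕ → ℚ
sign zero          = 1ℚ   -- unused (indices start at 1); (-1)^(-1) = -1 would be natural but never used
sign (suc zero)    = 1ℚ
sign (suc (suc i)) = - sign (suc i)

fromℕ : ℕ → ℚ
fromℕ n = (+ n) / 1

-- 1 / i^r for i ≥ 1 (value at i = 0 is irrelevant: only used for i ≥ 1)
invPow : ℕ → ℕ → ℚ
invPow zero    r = 0ℚ
invPow (suc i) r = (+ 1) / (suc i ^ r)
  where instance _ = m^n≢0 (suc i) r

H : ℕ → ℕ → ℚ
H n r = sum1 n (λ i → invPow i r)

S : ℕ → ℕ → ℚ
S k m = sum1 k (λ j → fromℕ (k C j) * sign j * invPow j m)

-- Write T_n f = Σ_{k=0}^n (-1)^k C(n,k) f(k) for the binomial transform.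
-- Pascal's rule gives T_{n+1} f = T_n f - T_n (f ∘ suc), and from this,
-- by induction on n (for all f at once), the transform is an involution:
-- T_n (k ↦ T_k a) = a(n).  Since S_k(m) = -T_k a for a(j) = j^(-m), this
-- yields the inversion formula  Σ_{k=1}^N (-1)^(k-1) C(N,k) S_k(m) = N^(-m).
--
-- The corollary then follows by induction on n: Pascal's rule together with
-- the absorption identity C(n,k-1)/k = C(n+1,k)/(n+1) splits the (n+1)-th sum
-- into the n-th sum plus 1/(n+1) times the inversion sum for N = n+1, i.e.
-- plus (n+1)^(-(m+1)).
module Submission where

open import Defs
open import Data.Nat as ℕ using (ℕ; zero; suc; _≥_; NonZero)
open import Data.Nat.Properties as ℕ using (m*n≢0; m^n≢0; n<1+n)
open import Data.Nat.Combinatorics using (_C_; nCk+nC[k+1]≡[n+1]C[k+1]; k>n⇒nCk≡0; nC1≡n)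
open import Data.Integer as ℤ using (+_)
import Data.Integer.Properties as ℤ
open import Data.Rational using (ℚ; 0ℚ; 1ℚ; _+_; _*_; -_; _-_; _/_; fromℚᵘ; toℚᵘ)
open import Data.Rational.Properties
  using ( toℚᵘ-fromℚᵘ; fromℚᵘ-toℚᵘ; fromℚᵘ-cong; toℚᵘ-homo-+; toℚᵘ-homo-*; /-cong
        ; +-identityˡ; +-identityʳ; *-identityˡ; *-identityʳ; *-comm; *-zeroˡ; *-zeroʳ; +-assoc
        ; *-distribˡ-+; neg-distrib-+; neg-distribˡ-* )
open import Data.Rational.Solver using (module +-*-Solver)
open import Data.Rational.Unnormalised as ℚᵘ using (mkℚᵘ; *≡*)
import Data.Rational.Unnormalised.Properties as ℚᵘ
open import Relation.Binary.PropositionalEquality using (_≡_; refl; sym; trans; cong; cong₂; module ≡-Reasoning)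

open +-*-Solver using (solve; _:+_; _:*_; :-_; _:-_; _:=_; con)
open ≡-Reasoning

-- Arithmetic of fractions.  Normalisation fromℚᵘ of unnormalised rationals
-- preserves + and *, which reduces identities between fractions a/b to
-- identities between integers.
fromℚᵘ-homo-+ : ∀ p q → fromℚᵘ (p ℚᵘ.+ q) ≡ fromℚᵘ p + fromℚᵘ q
fromℚᵘ-homo-+ p q = begin
  fromℚᵘ (p ℚᵘ.+ q)                             ≡⟨ fromℚᵘ-cong (ℚᵘ.+-cong (ℚᵘ.≃-sym (toℚᵘ-fromℚᵘ p)) (ℚᵘ.≃-sym (toℚᵘ-fromℚᵘ q))) ⟩
  fromℚᵘ (toℚᵘ (fromℚᵘ p) ℚᵘ.+ toℚᵘ (fromℚᵘ q)) ≡⟨ fromℚᵘ-cong (ℚᵘ.≃-sym (toℚᵘ-homo-+ (fromℚᵘ p) (fromℚᵘ q))) ⟩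
  fromℚᵘ (toℚᵘ (fromℚᵘ p + fromℚᵘ q))           ≡⟨ fromℚᵘ-toℚᵘ (fromℚᵘ p + fromℚᵘ q) ⟩
  fromℚᵘ p + fromℚᵘ q                           ∎

fromℚᵘ-homo-* : ∀ p q → fromℚᵘ (p ℚᵘ.* q) ≡ fromℚᵘ p * fromℚᵘ q
fromℚᵘ-homo-* p q = begin
  fromℚᵘ (p ℚᵘ.* q)                             ≡⟨ fromℚᵘ-cong (ℚᵘ.*-cong (ℚᵘ.≃-sym (toℚᵘ-fromℚᵘ p)) (ℚᵘ.≃-sym (toℚᵘ-fromℚᵘ q))) ⟩
  fromℚᵘ (toℚᵘ (fromℚᵘ p) ℚᵘ.* toℚᵘ (fromℚᵘ q)) ≡⟨ fromℚᵘ-cong (ℚᵘ.≃-sym (toℚᵘ-homo-* (fromℚᵘ p) (fromℚᵘ q))) ⟩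
  fromℚᵘ (toℚᵘ (fromℚᵘ p * fromℚᵘ q))           ≡⟨ fromℚᵘ-toℚᵘ (fromℚᵘ p * fromℚᵘ q) ⟩
  fromℚᵘ p * fromℚᵘ q                           ∎

frac-* : ∀ a b c d .{{_ : NonZero b}} .{{_ : NonZero d}} →
         ((+ a) / b) * ((+ c) / d) ≡ ((+ (a ℕ.* c)) / (b ℕ.* d)) {{m*n≢0 b d}}
frac-* a (suc b) c (suc d) = trans (sym (fromℚᵘ-homo-* (mkℚᵘ (+ a) b) (mkℚᵘ (+ c) d)))
                                   (/-cong (sym (ℤ.pos-* a c)) refl)

fromℕ-+ : ∀ a b → fromℕ (a ℕ.+ b) ≡ fromℕ a + fromℕ b
fromℕ-+ a b = trans (/-cong numerators refl) (fromℚᵘ-homo-+ (mkℚᵘ (+ a) 0) (mkℚᵘ (+ b) 0))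
  where
  numerators : + (a ℕ.+ b) ≡ + a ℤ.* + 1 ℤ.+ + b ℤ.* + 1
  numerators = trans (ℤ.pos-+ a b) (sym (cong₂ ℤ._+_ (ℤ.*-identityʳ (+ a)) (ℤ.*-identityʳ (+ b))))

fromℕ-* : ∀ a b → fromℕ (a ℕ.* b) ≡ fromℕ a * fromℕ b
fromℕ-* a b = sym (frac-* a 1 b 1)

fromℕ-invPow : ∀ n → fromℕ (suc n) * invPow (suc n) 1 ≡ 1ℚ
fromℕ-invPow n = begin
  fromℕ (suc n) * invPow (suc n) 1           ≡⟨ frac-* (suc n) 1 1 (suc n ℕ.^ 1) ⟩
  (+ (suc n ℕ.* 1)) / (1 ℕ.* (suc n ℕ.^ 1))  ≡⟨ /-cong (cong +_ (ℕ.*-identityʳ (suc n))) (trans (ℕ.*-identityˡ _) (ℕ.*-identityʳ (suc n))) ⟩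
  (+ suc n) / suc n                          ≡⟨ fromℚᵘ-cong {mkℚᵘ (+ suc n) n} {mkℚᵘ (+ 1) 0} (*≡* (ℤ.*-comm (+ suc n) (+ 1))) ⟩
  1ℚ                                         ∎

invPow-suc : ∀ n r → invPow (suc n) 1 * invPow (suc n) r ≡ invPow (suc n) (suc r)
invPow-suc n r = trans (frac-* 1 (suc n ℕ.^ 1) 1 (suc n ℕ.^ r))
                       (/-cong {p₁ = + 1} {p₂ = + 1} refl (cong (ℕ._* (suc n ℕ.^ r)) (ℕ.*-identityʳ (suc n))))
  where
  instance
    _ = m^n≢0 (suc n) 1
    _ = m^n≢0 (suc n) r
    _ = m^n≢0 (suc n) (suc r)
    _ = m*n≢0 (suc n ℕ.^ 1) (suc n ℕ.^ r)

sum1-cong : ∀ n {f g : ℕ → ℚ} → (∀ k → f (suc k) ≡ g (suc k)) → sum1 n f ≡ sum1 n g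
sum1-cong zero    f≗g = refl
sum1-cong (suc n) f≗g = cong₂ _+_ (sum1-cong n f≗g) (f≗g n)

sum1-+ : ∀ n (f g : ℕ → ℚ) → sum1 n (λ k → f k + g k) ≡ sum1 n f + sum1 n g
sum1-+ zero    f g = refl
sum1-+ (suc n) f g = trans (cong (_+ (f (suc n) + g (suc n))) (sum1-+ n f g))
  (solve 4 (λ a b c d → (a :+ b) :+ (c :+ d) := (a :+ c) :+ (b :+ d)) refl
    (sum1 n f) (sum1 n g) (f (suc n)) (g (suc n)))

sum1-neg : ∀ n (f : ℕ → ℚ) → sum1 n (λ k → - f k) ≡ - sum1 n f
sum1-neg zero    f = refl
sum1-neg (suc n) f = trans (cong (_+ - f (suc n)) (sum1-neg n f))
                           (sym (neg-distrib-+ (sum1 n f) (f (suc n))))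

sum1-*ˡ : ∀ n c (f : ℕ → ℚ) → sum1 n (λ k → c * f k) ≡ c * sum1 n f
sum1-*ˡ zero    c f = sym (*-zeroʳ c)
sum1-*ˡ (suc n) c f = trans (cong (_+ c * f (suc n)) (sum1-*ˡ n c f))
                            (sym (*-distribˡ-+ c (sum1 n f) (f (suc n))))

sum1-dropLast : ∀ n (f : ℕ → ℚ) → f (suc n) ≡ 0ℚ → sum1 (suc n) f ≡ sum1 n f
sum1-dropLast n f last≡0 = trans (cong (_+_ (sum1 n f)) last≡0) (+-identityʳ (sum1 n f))

sum0 : ℕ → (ℕ → ℚ) → ℚ
sum0 n f = f 0 + sum1 n f

sum0-cong : ∀ n {f g : ℕ → ℚ} → (∀ k → f k ≡ g k) → sum0 n f ≡ sum0 n g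
sum0-cong n f≗g = cong₂ _+_ (f≗g 0) (sum1-cong n (λ k → f≗g (suc k)))

sum0-+ : ∀ n (f g : ℕ → ℚ) → sum0 n (λ k → f k + g k) ≡ sum0 n f + sum0 n g
sum0-+ n f g = trans (cong (_+_ (f 0 + g 0)) (sum1-+ n f g))
  (solve 4 (λ a b c d → (a :+ b) :+ (c :+ d) := (a :+ c) :+ (b :+ d)) refl
    (f 0) (g 0) (sum1 n f) (sum1 n g))

sum0-neg : ∀ n (f : ℕ → ℚ) → sum0 n (λ k → - f k) ≡ - sum0 n f
sum0-neg n f = trans (cong (_+_ (- f 0)) (sum1-neg n f)) (sym (neg-distrib-+ (f 0) (sum1 n f)))

sum1-shift : ∀ n (h : ℕ → ℚ) → sum1 (suc n) h ≡ sum0 n (λ k → h (suc k))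
sum1-shift zero    h = trans (+-identityˡ (h 1)) (sym (+-identityʳ (h 1)))
sum1-shift (suc n) h = trans (cong (_+ h (suc (suc n))) (sum1-shift n h))
                             (+-assoc (h 1) _ _)

sg : ℕ → ℚ
sg zero    = 1ℚ
sg (suc k) = - sg k

sign-sg : ∀ k → sign (suc k) ≡ - sg (suc k)
sign-sg zero    = refl
sign-sg (suc k) = cong -_ (sign-sg k)

signed-sum : ∀ n (g : ℕ → ℚ) → g 0 ≡ 0ℚ →
             sum1 n (λ k → sign k * g k) ≡ - sum0 n (λ k → sg k * g k)
signed-sum n g g0≡0 = begin
  sum1 n (λ k → sign k * g k)         ≡⟨ sum1-cong n flip-sign ⟩
  sum1 n (λ k → - (sg k * g k))       ≡⟨ sum1-neg n (λ k → sg k * g k) ⟩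
  - sum1 n (λ k → sg k * g k)         ≡⟨ cong -_ (sym (+-identityˡ _)) ⟩
  -- the k = 0 term of sum0 is sg 0 * g 0 = 1 * 0
  - (0ℚ + sum1 n (λ k → sg k * g k))  ≡⟨ cong (λ x → - (1ℚ * x + sum1 n (λ k → sg k * g k))) (sym g0≡0) ⟩
  - sum0 n (λ k → sg k * g k)         ∎
  where
  flip-sign : ∀ k → sign (suc k) * g (suc k) ≡ - (sg (suc k) * g (suc k))
  flip-sign k = trans (cong (_* g (suc k)) (sign-sg k)) (sym (neg-distribˡ-* (sg (suc k)) (g (suc k))))

transform : ℕ → (ℕ → ℚ) → ℚ
transform n f = sum0 n (λ k → sg k * (fromℕ (n C k) * f k))

transform-cong : ∀ n {f g : ℕ → ℚ} → (∀ k → f k ≡ g k) → transform n f ≡ transform n g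
transform-cong n f≗g = sum0-cong n (λ k → cong (λ x → sg k * (fromℕ (n C k) * x)) (f≗g k))

transform-zero : ∀ (f : ℕ → ℚ) → transform 0 f ≡ f 0
transform-zero f = trans (+-identityʳ _) (trans (*-identityˡ _) (*-identityˡ (f 0)))

transform-neg : ∀ n (f : ℕ → ℚ) → transform n (λ k → - f k) ≡ - transform n f
transform-neg n f = trans (sum0-cong n pull-out) (sum0-neg n (λ k → sg k * (fromℕ (n C k) * f k)))
  where
  pull-out : ∀ k → sg k * (fromℕ (n C k) * - f k) ≡ - (sg k * (fromℕ (n C k) * f k))
  pull-out k = solve 3 (λ s c x → s :* (c :* :- x) := :- (s :* (c :* x))) refl (sg k) (fromℕ (n C k)) (f k)

transform-sub : ∀ n (f g : ℕ → ℚ) → transform n (λ k → f k - g k) ≡ transform n f - transform n g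
transform-sub n f g = begin
  transform n (λ k → f k - g k)        ≡⟨ sum0-cong n distribute ⟩
  sum0 n (λ k → F k + - G k)           ≡⟨ sum0-+ n F (λ k → - G k) ⟩
  sum0 n F + sum0 n (λ k → - G k)      ≡⟨ cong (_+_ (sum0 n F)) (sum0-neg n G) ⟩
  transform n f - transform n g        ∎
  where
  F G : ℕ → ℚ
  F k = sg k * (fromℕ (n C k) * f k)
  G k = sg k * (fromℕ (n C k) * g k)
  distribute : ∀ k → sg k * (fromℕ (n C k) * (f k - g k)) ≡ F k + - G k
  distribute k = solve 4 (λ s c x y → s :* (c :* (x :- y)) := s :* (c :* x) :+ :- (s :* (c :* y))) refl
                   (sg k) (fromℕ (n C k)) (f k) (g k)

transform-pascal : ∀ n (f : ℕ → ℚ) →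
                   transform (suc n) f ≡ transform n f - transform n (λ k → f (suc k))
transform-pascal n f = begin
  transform (suc n) f                              ≡⟨ cong (_+_ (d 0)) (sum1-shift n c) ⟩
  d 0 + sum0 n (λ k → c (suc k))                   ≡⟨ cong (_+_ (d 0)) (sum0-cong n split) ⟩
  d 0 + sum0 n (λ k → d (suc k) + - e k)           ≡⟨ cong (_+_ (d 0)) (sum0-+ n (λ k → d (suc k)) (λ k → - e k)) ⟩
  d 0 + (sum0 n (λ k → d (suc k)) + sum0 n (λ k → - e k))
    ≡⟨ cong₂ (λ x y → d 0 + (x + y)) (sym (sum1-shift n d)) (sum0-neg n e) ⟩
  d 0 + (sum1 (suc n) d + - sum0 n e)              ≡⟨ cong (λ x → d 0 + (x + - sum0 n e)) (sum1-dropLast n d top≡0) ⟩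
  d 0 + (sum1 n d + - sum0 n e)                    ≡⟨ sym (+-assoc (d 0) (sum1 n d) (- sum0 n e)) ⟩
  transform n f - transform n (λ k → f (suc k))    ∎
  where
  c d e : ℕ → ℚ
  c k = sg k * (fromℕ (suc n C k) * f k)
  d k = sg k * (fromℕ (n C k) * f k)
  e k = sg k * (fromℕ (n C k) * f (suc k))
  split : ∀ k → c (suc k) ≡ d (suc k) + - e k
  split k = begin
    - sg k * (fromℕ (suc n C suc k) * f (suc k))
      ≡⟨ cong (λ x → - sg k * (x * f (suc k)))
              (trans (cong fromℕ (sym (nCk+nC[k+1]≡[n+1]C[k+1] n k))) (fromℕ-+ (n C k) (n C suc k))) ⟩
    - sg k * ((fromℕ (n C k) + fromℕ (n C suc k)) * f (suc k))
      ≡⟨ solve 4 (λ s a b x → :- s :* ((a :+ b) :* x) := :- s :* (b :* x) :+ :- (s :* (a :* x))) refl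
           (sg k) (fromℕ (n C k)) (fromℕ (n C suc k)) (f (suc k)) ⟩
    d (suc k) + - e k ∎
  top≡0 : d (suc n) ≡ 0ℚ
  top≡0 = trans (cong (λ x → sg (suc n) * (fromℕ x * f (suc n))) (k>n⇒nCk≡0 (n<1+n n)))
                (trans (cong (sg (suc n) *_) (*-zeroˡ (f (suc n)))) (*-zeroʳ (sg (suc n))))

transform-involutive : ∀ n (a : ℕ → ℚ) → transform n (λ k → transform k a) ≡ a n
transform-involutive zero    a = trans (transform-zero (λ k → transform k a)) (transform-zero a)
transform-involutive (suc n) a = begin
  transform (suc n) (λ k → transform k a)
    ≡⟨ transform-pascal n (λ k → transform k a) ⟩
  transform n (λ k → transform k a) - transform n (λ k → transform (suc k) a)
    ≡⟨ sym (transform-sub n (λ k → transform k a) (λ k → transform (suc k) a)) ⟩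
  transform n (λ k → transform k a - transform (suc k) a)
    ≡⟨ transform-cong n difference ⟩
  transform n (λ k → transform k (λ j → a (suc j)))
    ≡⟨ transform-involutive n (λ j → a (suc j)) ⟩
  a (suc n) ∎
  where
  difference : ∀ k → transform k a - transform (suc k) a ≡ transform k (λ j → a (suc j))
  difference k = trans (cong (λ x → transform k a - x) (transform-pascal k a))
    (solve 2 (λ x y → x :- (x :- y) := y) refl (transform k a) (transform k (λ j → a (suc j))))

Σ± : ℕ → (ℕ → ℚ) → ℚ
Σ± n b = sum1 n (λ k → sign k * fromℕ (n C k) * b k)

Σ±/k : ℕ → (ℕ → ℚ) → ℚ
Σ±/k n b = sum1 n (λ k → sign k * fromℕ (n C k) * b k * invPow k 1)

Σ±-transform : ∀ n (b : ℕ → ℚ) → b 0 ≡ 0ℚ → Σ± n b ≡ - transform n b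
Σ±-transform n b b0≡0 = trans (sum1-cong n reassociate) (signed-sum n (λ k → fromℕ (n C k) * b k) (cong (1ℚ *_) b0≡0))
  where
  reassociate : ∀ k → sign (suc k) * fromℕ (n C suc k) * b (suc k) ≡ sign (suc k) * (fromℕ (n C suc k) * b (suc k))
  reassociate k = solve 3 (λ s c x → s :* c :* x := s :* (c :* x)) refl (sign (suc k)) (fromℕ (n C suc k)) (b (suc k))

S-transform : ∀ k m → S k m ≡ - transform k (λ j → invPow j m)
S-transform k m = trans (sum1-cong k reorder) (Σ±-transform k (λ j → invPow j m) refl)
  where
  reorder : ∀ j → fromℕ (k C suc j) * sign (suc j) * invPow (suc j) m
                ≡ sign (suc j) * fromℕ (k C suc j) * invPow (suc j) m
  reorder j = solve 3 (λ c s x → c :* s :* x := s :* c :* x) refl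
                (fromℕ (k C suc j)) (sign (suc j)) (invPow (suc j) m)

S-inversion : ∀ N m → Σ± N (λ k → S k m) ≡ invPow N m
S-inversion N m = begin
  Σ± N (λ k → S k m)                          ≡⟨ Σ±-transform N (λ k → S k m) refl ⟩
  - transform N (λ k → S k m)                 ≡⟨ cong -_ (transform-cong N (λ k → S-transform k m)) ⟩
  - transform N (λ k → - transform k a)       ≡⟨ cong -_ (transform-neg N (λ k → transform k a)) ⟩
  - - transform N (λ k → transform k a)       ≡⟨ solve 1 (λ x → :- (:- x) := x) refl _ ⟩
  transform N (λ k → transform k a)           ≡⟨ transform-involutive N a ⟩
  invPow N m                                  ∎
  where
  a : ℕ → ℚ
  a j = invPow j m

absorption : ∀ n k → suc k ℕ.* (suc n C suc k) ≡ suc n ℕ.* (n C k)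
absorption zero    zero    = refl
absorption zero    (suc k) = ℕ.*-zeroʳ (suc (suc k))
absorption (suc n) zero    = trans (ℕ.*-identityˡ _) (trans (nC1≡n (suc (suc n))) (sym (ℕ.*-identityʳ (suc (suc n)))))
absorption (suc n) (suc k) = begin
  suc (suc k) ℕ.* (suc (suc n) C suc (suc k))         ≡⟨ cong (suc (suc k) ℕ.*_) (sym (nCk+nC[k+1]≡[n+1]C[k+1] (suc n) (suc k))) ⟩
  suc (suc k) ℕ.* (X ℕ.+ Y)                           ≡⟨ rearrange ⟩
  X ℕ.+ (suc k ℕ.* X ℕ.+ suc (suc k) ℕ.* Y)           ≡⟨ cong₂ (λ u v → X ℕ.+ (u ℕ.+ v)) (absorption n k) (absorption n (suc k)) ⟩
  X ℕ.+ (suc n ℕ.* (n C k) ℕ.+ suc n ℕ.* (n C suc k)) ≡⟨ cong (X ℕ.+_) (sym (ℕ.*-distribˡ-+ (suc n) (n C k) (n C suc k))) ⟩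
  X ℕ.+ suc n ℕ.* ((n C k) ℕ.+ (n C suc k))           ≡⟨ cong (λ u → X ℕ.+ suc n ℕ.* u) (nCk+nC[k+1]≡[n+1]C[k+1] n k) ⟩
  suc (suc n) ℕ.* X                                   ∎
  where
  X Y : ℕ
  X = suc n C suc k
  Y = suc n C suc (suc k)
  rearrange : suc (suc k) ℕ.* (X ℕ.+ Y) ≡ X ℕ.+ (suc k ℕ.* X ℕ.+ suc (suc k) ℕ.* Y)
  rearrange = trans (ℕ.*-distribˡ-+ (suc (suc k)) X Y) (ℕ.+-assoc X (suc k ℕ.* X) (suc (suc k) ℕ.* Y))

absorption-ℚ : ∀ n k → fromℕ (n C k) * invPow (suc k) 1 ≡ invPow (suc n) 1 * fromℕ (suc n C suc k)
absorption-ℚ n k = begin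
  c * u              ≡⟨ sym (*-identityˡ (c * u)) ⟩
  1ℚ * (c * u)       ≡⟨ cong (_* (c * u)) (sym (trans (*-comm w N) (fromℕ-invPow n))) ⟩
  (w * N) * (c * u)  ≡⟨ solve 4 (λ w N c u → (w :* N) :* (c :* u) := w :* (N :* c) :* u) refl w N c u ⟩
  w * (N * c) * u    ≡⟨ cong (λ x → w * x * u) Nc≡Kd ⟩
  w * (K * d) * u    ≡⟨ solve 4 (λ w K d u → w :* (K :* d) :* u := w :* d :* (K :* u)) refl w K d u ⟩
  w * d * (K * u)    ≡⟨ cong (w * d *_) (fromℕ-invPow k) ⟩
  w * d * 1ℚ         ≡⟨ *-identityʳ (w * d) ⟩
  w * d              ∎
  where
  c u w N K d : ℚ
  c = fromℕ (n C k)
  u = invPow (suc k) 1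
  w = invPow (suc n) 1
  N = fromℕ (suc n)
  K = fromℕ (suc k)
  d = fromℕ (suc n C suc k)
  Nc≡Kd : N * c ≡ K * d
  Nc≡Kd = begin
    N * c                                ≡⟨ sym (fromℕ-* (suc n) (n C k)) ⟩
    fromℕ (suc n ℕ.* (n C k))            ≡⟨ cong fromℕ (sym (absorption n k)) ⟩
    fromℕ (suc k ℕ.* (suc n C suc k))    ≡⟨ fromℕ-* (suc k) (suc n C suc k) ⟩
    K * d                                ∎

Σ±/k-step : ∀ n (b : ℕ → ℚ) → Σ±/k (suc n) b ≡ Σ±/k n b + invPow (suc n) 1 * Σ± (suc n) b
Σ±/k-step n b = begin
  Σ±/k (suc n) b                                        ≡⟨ sum1-cong (suc n) split ⟩
  sum1 (suc n) (λ k → f k + w * g k)                    ≡⟨ sum1-+ (suc n) f (λ k → w * g k) ⟩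
  sum1 (suc n) f + sum1 (suc n) (λ k → w * g k)         ≡⟨ cong₂ _+_ (sum1-dropLast n f top≡0) (sum1-*ˡ (suc n) w g) ⟩
  Σ±/k n b + w * Σ± (suc n) b                           ∎
  where
  w : ℚ
  w = invPow (suc n) 1
  f g : ℕ → ℚ
  f k = sign k * fromℕ (n C k) * b k * invPow k 1
  g k = sign k * fromℕ (suc n C k) * b k
  split : ∀ i → sign (suc i) * fromℕ (suc n C suc i) * b (suc i) * invPow (suc i) 1 ≡ f (suc i) + w * g (suc i)
  split i = begin
    s * fromℕ (suc n C suc i) * x * v
      ≡⟨ cong (λ y → s * y * x * v) (trans (cong fromℕ (sym (nCk+nC[k+1]≡[n+1]C[k+1] n i))) (fromℕ-+ (n C i) (n C suc i))) ⟩
    s * (a + c) * x * v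
      ≡⟨ solve 5 (λ s a c x v → s :* (a :+ c) :* x :* v := s :* c :* x :* v :+ s :* x :* (a :* v)) refl s a c x v ⟩
    s * c * x * v + s * x * (a * v)
      ≡⟨ cong (λ y → s * c * x * v + s * x * y) (absorption-ℚ n i) ⟩
    s * c * x * v + s * x * (w * d)
      ≡⟨ solve 6 (λ s c x v w d → s :* c :* x :* v :+ s :* x :* (w :* d) := s :* c :* x :* v :+ w :* (s :* d :* x)) refl s c x v w d ⟩
    f (suc i) + w * g (suc i) ∎
    where
    s a c x v d : ℚ
    s = sign (suc i)
    a = fromℕ (n C i)
    c = fromℕ (n C suc i)
    x = b (suc i)
    v = invPow (suc i) 1
    d = fromℕ (suc n C suc i)
  top≡0 : f (suc n) ≡ 0ℚ
  top≡0 = trans (cong (λ y → sign (suc n) * fromℕ y * b (suc n) * invPow (suc n) 1) (k>n⇒nCk≡0 (n<1+n n)))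
    (solve 3 (λ s x v → s :* con 0ℚ :* x :* v := con 0ℚ) refl (sign (suc n)) (b (suc n)) w)

-- Corollary 2.2.  (The identity in fact holds for all n and m.)
corollary2p2 : (n m : ℕ) → n ≥ 1 → m ≥ 1 → sum1 n (λ k → sign k * fromℕ (n C k) * S k m * invPow k 1) ≡ H n (suc m)
corollary2p2 n m _ _ = harmonic n
  where
  harmonic : ∀ n → Σ±/k n (λ k → S k m) ≡ H n (suc m)
  harmonic zero    = refl
  harmonic (suc n) = begin
    Σ±/k (suc n) (λ k → S k m)                                         ≡⟨ Σ±/k-step n (λ k → S k m) ⟩
    Σ±/k n (λ k → S k m) + invPow (suc n) 1 * Σ± (suc n) (λ k → S k m) ≡⟨ cong₂ (λ x y → x + invPow (suc n) 1 * y) (harmonic n) (S-inversion (suc n) m) ⟩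
    H n (suc m) + invPow (suc n) 1 * invPow (suc n) m                  ≡⟨ cong (_+_ (H n (suc m))) (invPow-suc n m) ⟩
    H (suc n) (suc m)                                                  ∎
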